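{- Let $G$ be a graph with no isolated vertices. If $G$ has an end-vertex $w$ with (unique) neighbour $x$ such that the subgraph induced by $N(x)\setminus\{w\}$ is not complete, then $G$ is not $\gamma_{tR}$-edge-critical.
   Context: All graphs are finite and simple; $N(x)$ is the open neighbourhood of $x$. For a graph $G$ with no isolated vertices, a total Roman dominating function is a map $f:V(G)\to\{0,1,2\}$ such that every vertex with $f(v)=0$ is adjacent to a vertex $u$ with $f(u)=2$, and the subgraph induced by $\{v:f(v)>0\}$ has no isolated vertices; $\gamma_{tR}(G)$ is the minimum of $\sum_v f(v)$ over such $f$. $G$ is $\gamma_{tR}$-edge-critical if $E(\overline{G})\neq\emptyset$ and $\gamma_{tR}(G+e)<\gamma_{tR}(G)$ for every $e\in E(\overline{G})$. -}

module Defs where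

open import Data.Nat using (ℕ; _≤_)
open import Data.Fin using (Fin)
open import Data.Product using (∃-syntax; _×_; _,_; proj₁)
open import Data.Sum using (_⊎_; inj₁; inj₂)
open import Relation.Nullary using (¬_)
open import Relation.Binary.PropositionalEquality using (_≡_; _≢_; refl; sym; trans)
open import Data.List using (map)
open import Data.Nat.ListAction using (sum)
open import Data.List.Base using (allFin)

record Graph (n : ℕ) : Set₁ where
  field
    Adj     : Fin n → Fin n → Set
    adjSym  : ∀ {u v} → Adj u v → Adj v u
    adjIrr  : ∀ {v} → ¬ Adj v v
open Graph public

NoIsolated : ∀ {n} → Graph n → Set
NoIsolated G = ∀ v → ∃[ u ] Adj G v u

data Val : Set where
  v0 v1 v2 : Val

val : Val → ℕ
val v0 = 0
val v1 = 1
val v2 = 2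

weight : ∀ {n} → (Fin n → Val) → ℕ
weight {n} f = sum (map (λ v → val (f v)) (allFin n))

IsTRDF : ∀ {n} → Graph n → (Fin n → Val) → Set
IsTRDF G f =
  (∀ v → f v ≡ v0 → ∃[ u ] (Adj G v u × f u ≡ v2)) ×
  (∀ v → f v ≢ v0 → ∃[ u ] (Adj G v u × f u ≢ v0))

IsγtR : ∀ {n} → Graph n → ℕ → Set
IsγtR G k =
  (∃[ f ] (IsTRDF G f × weight f ≡ k)) ×
  (∀ f → IsTRDF G f → k ≤ weight f)

NonEdge : ∀ {n} → Graph n → Fin n → Fin n → Set
NonEdge G u v = (u ≢ v) × ¬ Adj G u v

plus : ∀ {n} (G : Graph n) (u v : Fin n) → u ≢ v → Graph n
plus G u v u≢v = record
  { Adj    = λ x y → Adj G x y ⊎ ((x ≡ u × y ≡ v) ⊎ (x ≡ v × y ≡ u))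
  ; adjSym = s
  ; adjIrr = i }
  where
  s : ∀ {x y} → Adj G x y ⊎ ((x ≡ u × y ≡ v) ⊎ (x ≡ v × y ≡ u))
              → Adj G y x ⊎ ((y ≡ u × x ≡ v) ⊎ (y ≡ v × x ≡ u))
  s (inj₁ a) = inj₁ (adjSym G a)
  s (inj₂ (inj₁ (p , q))) = inj₂ (inj₂ (q , p))
  s (inj₂ (inj₂ (p , q))) = inj₂ (inj₁ (q , p))
  i : ∀ {x} → ¬ (Adj G x x ⊎ ((x ≡ u × x ≡ v) ⊎ (x ≡ v × x ≡ u)))
  i (inj₁ a) = adjIrr G a
  i (inj₂ (inj₁ (p , q))) = u≢v (trans (sym p) q)
  i (inj₂ (inj₂ (p , q))) = u≢v (trans (sym q) p)

open import Data.Nat using (_<_)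
EdgeCritical : ∀ {n} → Graph n → Set
EdgeCritical G =
  (∃[ u ] ∃[ v ] NonEdge G u v) ×
  (∀ u v (e : NonEdge G u v) → ∀ k k′ →
     IsγtR G k → IsγtR (plus G u v (proj₁ e)) k′ → k′ < k)

EndVertexWith : ∀ {n} → Graph n → Fin n → Fin n → Set
EndVertexWith G w x = Adj G w x × (∀ y → Adj G w y → y ≡ x)

NbhdMinusComplete : ∀ {n} → Graph n → Fin n → Fin n → Set
NbhdMinusComplete G x w =
  ∀ y z → Adj G x y → y ≢ w → Adj G x z → z ≢ w → y ≢ z → Adj G y z

-- Let y, z be non-adjacent vertices of N(x) \ {w}. Every total Roman
-- dominating function f of G + yz yields one of G of the same weight, so
-- γtR(G) ≤ γtR(G + yz). Since w needs x, f(x) > 0. If f(x) = 1, move one unit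
-- from the leaf w to its support x; when f(w) = 1 the vertex x then still needs
-- a positive neighbour besides w, which y or z provides unless f(y) = f(z) = 0,
-- in which case f never uses the edge yz. Once f(x) = 2, the common neighbour
-- x does everything the edge yz did.
-- Minima and the pair y, z exist only up to double negation, which suffices
-- because the goal is ⊥.
module Submission where

open import Defs
open import Data.Nat using (ℕ; zero; suc; _+_; _≤_; _<_)
open import Data.Nat.Properties using (+-assoc; +-cancelʳ-≡; ≮⇒≥; ≤⇒≯; +-commutativeSemigroup)
open import Algebra.Properties.CommutativeSemigroup +-commutativeSemigroup
  using (xy∙z≈zy∙x; xy∙z≈xz∙y; x∙yz≈xz∙y)
open import Data.Nat.Induction using (<-rec)
open import Data.Fin using (Fin; zero; suc)
open import Data.Fin.Properties using (_≟_)
open import Data.Vec.Functional using (updateAt)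
open import Data.Vec.Functional.Properties using (updateAt-updates; updateAt-minimal)
open import Data.List.Properties using (map-tabulate)
open import Data.Nat.ListAction using (sum)
open import Data.Product using (∃; ∃-syntax; _×_; _,_; proj₁; proj₂; map₂)
open import Data.Sum using (inj₁; inj₂)
open import Data.Empty using (⊥)
open import Function using (_∘_; const; id)
open import Relation.Nullary using (¬_; Dec; yes; no; contradiction)
open import Relation.Nullary.Decidable using (¬¬-excluded-middle)
open import Relation.Nullary.Negation using (¬¬-Monad)
open import Relation.Binary.PropositionalEquality
  using (_≡_; _≢_; refl; sym; trans; cong; cong₂; subst; module ≡-Reasoning)
open import Effect.Monad using (RawMonad)
open import Level using (0ℓ)

open RawMonad (¬¬-Monad {0ℓ}) using (return; _>>=_)

private
  variable
    n : ℕ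

v2≢v0 : v2 ≢ v0
v2≢v0 ()

zero? : (a : Val) → Dec (a ≡ v0)
zero? v0 = yes refl
zero? v1 = no λ ()
zero? v2 = no λ ()

_[_≔_] : (Fin n → Val) → Fin n → Val → Fin n → Val
f [ i ≔ a ] = updateAt f i (const a)

weight-suc : (f : Fin (suc n) → Val) → weight f ≡ val (f zero) + weight (f ∘ suc)
weight-suc f = cong (λ l → val (f zero) + sum l)
  (trans (map-tabulate suc (val ∘ f)) (sym (map-tabulate id (val ∘ f ∘ suc))))

weight-[≔] : (f : Fin n → Val) (i : Fin n) (a : Val) →
             weight (f [ i ≔ a ]) + val (f i) ≡ weight f + val a
weight-[≔] f zero a = begin
  weight (f [ zero ≔ a ]) + val (f zero)  ≡⟨ cong (_+ val (f zero)) (weight-suc (f [ zero ≔ a ])) ⟩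
  (val a + weight tl) + val (f zero)      ≡⟨ xy∙z≈zy∙x (val a) _ _ ⟩
  (val (f zero) + weight tl) + val a      ≡⟨ cong (_+ val a) (weight-suc f) ⟨
  weight f + val a                        ∎
  where
  open ≡-Reasoning
  tl : Fin _ → Val
  tl = f ∘ suc
weight-[≔] f (suc i) a = begin
  weight (f [ suc i ≔ a ]) + val (tl i)                ≡⟨ cong (_+ val (tl i)) (weight-suc (f [ suc i ≔ a ])) ⟩
  (val (f zero) + weight (tl [ i ≔ a ])) + val (tl i)  ≡⟨ +-assoc (val (f zero)) _ _ ⟩
  val (f zero) + (weight (tl [ i ≔ a ]) + val (tl i))  ≡⟨ cong (val (f zero) +_) (weight-[≔] tl i a) ⟩
  val (f zero) + (weight tl + val a)                   ≡⟨ +-assoc (val (f zero)) _ _ ⟨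
  (val (f zero) + weight tl) + val a                   ≡⟨ cong (_+ val a) (weight-suc f) ⟨
  weight f + val a                                     ∎
  where
  open ≡-Reasoning
  tl : Fin _ → Val
  tl = f ∘ suc

weight-transfer : (f : Fin n → Val) {i j : Fin n} {a b : Val} → i ≢ j →
                  val a + val b ≡ val (f i) + val (f j) →
                  weight (f [ i ≔ a ] [ j ≔ b ]) ≡ weight f
weight-transfer f {i} {j} {a} {b} i≢j balance = +-cancelʳ-≡ _ _ _ (begin
  weight f₂ + (val (f i) + val (f j))   ≡⟨ x∙yz≈xz∙y (weight f₂) _ _ ⟩
  (weight f₂ + val (f j)) + val (f i)   ≡⟨ cong (λ c → weight f₂ + val c + val (f i)) f₁j≡fj ⟨
  (weight f₂ + val (f₁ j)) + val (f i)  ≡⟨ cong (_+ val (f i)) (weight-[≔] f₁ j b) ⟩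
  (weight f₁ + val b) + val (f i)       ≡⟨ xy∙z≈xz∙y (weight f₁) _ _ ⟩
  (weight f₁ + val (f i)) + val b       ≡⟨ cong (_+ val b) (weight-[≔] f i a) ⟩
  (weight f + val a) + val b            ≡⟨ +-assoc (weight f) _ _ ⟩
  weight f + (val a + val b)            ≡⟨ cong (weight f +_) balance ⟩
  weight f + (val (f i) + val (f j))    ∎)
  where
  open ≡-Reasoning
  f₁ f₂ : Fin _ → Val
  f₁ = f [ i ≔ a ]
  f₂ = f₁ [ j ≔ b ]
  f₁j≡fj : f₁ j ≡ f j
  f₁j≡fj = updateAt-minimal j i f (i≢j ∘ sym)

¬¬-∀-Fin : {P : Fin n → Set} → (∀ i → ¬ ¬ P i) → ¬ ¬ (∀ i → P i)
¬¬-∀-Fin {zero}  _  k = k λ ()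
¬¬-∀-Fin {suc n} ¬¬P k = ¬¬P zero λ p₀ → ¬¬-∀-Fin (¬¬P ∘ suc) λ ps →
  k λ { zero → p₀ ; (suc i) → ps i }

IsMinimum : {A : Set} → (A → ℕ) → (A → Set) → ℕ → Set
IsMinimum μ P k = (∃[ b ] (P b × μ b ≡ k)) × (∀ b → P b → k ≤ μ b)

¬¬-minimum : {A : Set} (μ : A → ℕ) (P : A → Set) {a : A} → P a →
             ¬ ¬ ∃ (IsMinimum μ P)
¬¬-minimum μ P {a} pa = <-rec Below step (μ a) a refl pa
  where
  Below : ℕ → Set
  Below m = ∀ a → μ a ≡ m → P a → ¬ ¬ ∃ (IsMinimum μ P)
  step : ∀ m → (∀ {m′} → m′ < m → Below m′) → Below m
  step m rec a refl pa = do
    smaller? ← ¬¬-excluded-middle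
    case smaller?
    where
    case : Dec (∃[ b ] (P b × μ b < μ a)) → ¬ ¬ ∃ (IsMinimum μ P)
    case (yes (b , pb , μb<μa)) = rec μb<μa b refl pb
    case (no none) = return (μ a , (a , pa , refl) , λ b pb → ≮⇒≥ λ lt → none (b , pb , lt))

module _ (H : Graph n) where

  ¬¬-γtR : {f : Fin n → Val} → IsTRDF H f → ¬ ¬ ∃ (IsγtR H)
  ¬¬-γtR = ¬¬-minimum weight (IsTRDF H)

  const-v2-isTRDF : NoIsolated H → IsTRDF H (const v2)
  const-v2-isTRDF noIsolated =
    (λ _ ()) , λ v _ → proj₁ (noIsolated v) , proj₂ (noIsolated v) , λ ()

  module _ {w x : Fin n} (leaf : EndVertexWith H w x) where

    via-leaf : {Q : Fin n → Set} → ∃[ u ] (Adj H w u × Q u) → Q x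
    via-leaf {Q} (u , wu , qu) = subst Q (proj₂ leaf u wu) qu

    support-two : {f : Fin n → Val} → IsTRDF H f → f w ≡ v0 → f x ≡ v2
    support-two (dominated , _) fw≡0 = via-leaf (dominated w fw≡0)

    support-positive : {f : Fin n → Val} → IsTRDF H f → f x ≢ v0
    support-positive {f} tf with zero? (f w)
    ... | yes fw≡0 = λ fx≡0 → v2≢v0 (trans (sym (support-two tf fw≡0)) fx≡0)
    ... | no fw≢0 = via-leaf (proj₂ tf w fw≢0)

    -- g w is unconstrained: x is the only vertex that sees w, and g x = 2.
    support-two-isTRDF : {f g : Fin n → Val} → IsTRDF H f → g x ≡ v2 →
                         (∀ v → v ≢ w → v ≢ x → g v ≡ f v) →
                         ∃[ t ] (Adj H x t × g t ≢ v0) → IsTRDF H g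
    support-two-isTRDF {f} {g} (dominated , total) gx≡2 agree xPositive =
      dominated′ , total′
      where
      gx≢0 : g x ≢ v0
      gx≢0 gx≡0 = v2≢v0 (trans (sym gx≡2) gx≡0)

      transport : (Q : Val → Set) → Q v2 → ∀ {v} → v ≢ x →
                  ∃[ u ] (Adj H v u × Q (f u)) → ∃[ u ] (Adj H v u × Q (g u))
      transport Q q₂ {v} v≢x (u , vu , qu) with u ≟ x | u ≟ w
      ... | yes refl | _        = x , vu , subst Q (sym gx≡2) q₂
      ... | no _     | yes refl = contradiction (proj₂ leaf v (adjSym H vu)) v≢x
      ... | no u≢x   | no u≢w   = u , vu , subst Q (sym (agree u u≢w u≢x)) qu

      dominated′ : ∀ v → g v ≡ v0 → ∃[ u ] (Adj H v u × g u ≡ v2)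
      dominated′ v gv≡0 with v ≟ w | v ≟ x
      ... | yes refl | _        = x , proj₁ leaf , gx≡2
      ... | no _     | yes refl = contradiction gv≡0 gx≢0
      ... | no v≢w   | no v≢x   =
        transport (_≡ v2) refl v≢x (dominated v (trans (sym (agree v v≢w v≢x)) gv≡0))

      total′ : ∀ v → g v ≢ v0 → ∃[ u ] (Adj H v u × g u ≢ v0)
      total′ v gv≢0 with v ≟ w | v ≟ x
      ... | yes refl | _        = x , proj₁ leaf , gx≢0
      ... | no _     | yes refl = xPositive
      ... | no v≢w   | no v≢x   =
        transport (_≢ v0) (λ ()) v≢x (total v (gv≢0 ∘ trans (agree v v≢w v≢x)))

module _ (G : Graph n) {y z : Fin n} (y≢z : y ≢ z) where

  private
    G+yz : Graph n
    G+yz = plus G y z y≢z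

  NoIsolated-plus : NoIsolated G → NoIsolated G+yz
  NoIsolated-plus noIsolated v = map₂ inj₁ (noIsolated v)

  EndVertexWith-plus : {w x : Fin n} → y ≢ w → z ≢ w →
                       EndVertexWith G w x → EndVertexWith G+yz w x
  EndVertexWith-plus {w} {x} y≢w z≢w (wx , unique) = inj₁ wx , unique′
    where
    unique′ : ∀ u → Adj G+yz w u → u ≡ x
    unique′ u (inj₁ wu)                = unique u wu
    unique′ u (inj₂ (inj₁ (w≡y , _))) = contradiction (sym w≡y) y≢w
    unique′ u (inj₂ (inj₂ (w≡z , _))) = contradiction (sym w≡z) z≢w

  dropEdge-commonNeighbour : {h : Fin n → Val} {x : Fin n} → Adj G x y → Adj G x z →
                             h x ≡ v2 → IsTRDF G+yz h → IsTRDF G h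
  dropEdge-commonNeighbour {h} {x} xy xz hx≡2 (dominated , total) =
    (λ v → reroute hx≡2 ∘ dominated v) , (λ v → reroute hx≢0 ∘ total v)
    where
    hx≢0 : h x ≢ v0
    hx≢0 hx≡0 = v2≢v0 (trans (sym hx≡2) hx≡0)

    reroute : {Q : Fin n → Set} → Q x → ∀ {v} →
              ∃[ u ] (Adj G+yz v u × Q u) → ∃[ u ] (Adj G v u × Q u)
    reroute _  (u , inj₁ vu , qu)               = u , vu , qu
    reroute qx (_ , inj₂ (inj₁ (refl , _)) , _) = x , adjSym G xy , qx
    reroute qx (_ , inj₂ (inj₂ (refl , _)) , _) = x , adjSym G xz , qx

  dropEdge-unused : {h : Fin n → Val} → h y ≡ v0 → h z ≡ v0 → IsTRDF G+yz h → IsTRDF G h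
  dropEdge-unused {h} hy≡0 hz≡0 (dominated , total) = dominated′ , total′
    where
    dominated′ : ∀ v → h v ≡ v0 → ∃[ u ] (Adj G v u × h u ≡ v2)
    dominated′ v hv≡0 with dominated v hv≡0
    ... | u , inj₁ vu , hu≡2                 = u , vu , hu≡2
    ... | _ , inj₂ (inj₁ (_ , refl)) , hz≡2 = contradiction (trans (sym hz≡2) hz≡0) v2≢v0
    ... | _ , inj₂ (inj₂ (_ , refl)) , hy≡2 = contradiction (trans (sym hy≡2) hy≡0) v2≢v0

    total′ : ∀ v → h v ≢ v0 → ∃[ u ] (Adj G v u × h u ≢ v0)
    total′ v hv≢0 with total v hv≢0
    ... | u , inj₁ vu , hu≢0              = u , vu , hu≢0
    ... | _ , inj₂ (inj₁ (refl , _)) , _ = contradiction hy≡0 hv≢0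
    ... | _ , inj₂ (inj₂ (refl , _)) , _ = contradiction hz≡0 hv≢0

  module _ {w x : Fin n} (leaf : EndVertexWith G w x)
           (xy : Adj G x y) (y≢w : y ≢ w) (xz : Adj G x z) (z≢w : z ≢ w) where

    private
      leaf′ : EndVertexWith G+yz w x
      leaf′ = EndVertexWith-plus y≢w z≢w leaf

      w≢x : w ≢ x
      w≢x refl = adjIrr G (proj₁ leaf)

      y≢x : y ≢ x
      y≢x refl = adjIrr G xy

      z≢x : z ≢ x
      z≢x refl = adjIrr G xz

      promoted : (Fin n → Val) → Val → Fin n → Val
      promoted f b = f [ w ≔ b ] [ x ≔ v2 ]

      promoted-agree : ∀ f b v → v ≢ w → v ≢ x → promoted f b v ≡ f v
      promoted-agree f b v v≢w v≢x =
        trans (updateAt-minimal v x (f [ w ≔ b ]) v≢x) (updateAt-minimal v w f v≢w)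

      promoted-positive : ∀ f b {t} → t ≢ w → t ≢ x → f t ≢ v0 → promoted f b t ≢ v0
      promoted-positive f b t≢w t≢x ft≢0 = ft≢0 ∘ trans (sym (promoted-agree f b _ t≢w t≢x))

      promoted-w : ∀ f b → promoted f b w ≡ b
      promoted-w f b = trans (updateAt-minimal w x (f [ w ≔ b ]) w≢x) (updateAt-updates w f)

    promote-support : {f : Fin n → Val} → IsTRDF G+yz f →
                      {a c : Val} → f w ≡ a → f x ≡ c →
                      (b : Val) → val b + val v2 ≡ val a + val c →
                      ∃[ t ] (Adj G+yz x t × promoted f b t ≢ v0) →
                      ∃[ g ] (IsTRDF G g × weight g ≡ weight f)
    promote-support {f} tf fw fx b balance xPositive =
      promoted f b ,
      dropEdge-commonNeighbour xy xz promoted-x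
        (support-two-isTRDF G+yz leaf′ tf promoted-x (promoted-agree f b) xPositive) ,
      weight-transfer f w≢x (trans balance (sym (cong₂ (λ a c → val a + val c) fw fx)))
      where
      promoted-x : promoted f b x ≡ v2
      promoted-x = updateAt-updates x (f [ w ≔ b ])

    trdf-plus⇒trdf : {f : Fin n → Val} → IsTRDF G+yz f →
                     ∃[ g ] (IsTRDF G g × weight g ≡ weight f)
    trdf-plus⇒trdf {f} tf with f x in fx
    ... | v0 = contradiction fx (support-positive G+yz leaf′ tf)
    ... | v2 = f , dropEdge-commonNeighbour xy xz fx tf , refl
    ... | v1 with f w in fw
    ...   | v0 = contradiction (trans (sym fx) (support-two G+yz leaf′ tf fw)) λ ()
    ...   | v2 = promote-support tf fw fx v1 refl
                   (w , adjSym G+yz (proj₁ leaf′) , subst (_≢ v0) (sym (promoted-w f v1)) λ ())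
    ...   | v1 with zero? (f y) | zero? (f z)
    ...     | yes fy≡0 | yes fz≡0 = f , dropEdge-unused fy≡0 fz≡0 tf , refl
    ...     | no fy≢0  | _        = promote-support tf fw fx v0 refl
                                      (y , inj₁ xy , promoted-positive f v0 y≢w y≢x fy≢0)
    ...     | _        | no fz≢0  = promote-support tf fw fx v0 refl
                                      (z , inj₁ xz , promoted-positive f v0 z≢w z≢x fz≢0)

    γtR≤γtR-plus : {k k′ : ℕ} → IsγtR G k → IsγtR G+yz k′ → k ≤ k′
    γtR≤γtR-plus {k} (_ , minimal) ((f , tf , weight≡k′) , _) with trdf-plus⇒trdf tf
    ... | g , tg , weight≡ = subst (k ≤_) (trans weight≡ weight≡k′) (minimal g tg)

¬¬-nonadjacentPair : (G : Graph n) {x w : Fin n} → ¬ NbhdMinusComplete G x w →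
  ¬ ¬ (∃[ y ] ∃[ z ] (Adj G x y × y ≢ w × Adj G x z × z ≢ w × NonEdge G y z))
¬¬-nonadjacentPair G {x} {w} notComplete noPair =
  ¬¬-∀-Fin (λ y → ¬¬-∀-Fin (adjacentIfNeighbours y)) notComplete
  where
  adjacentIfNeighbours : ∀ y z →
    ¬ ¬ (Adj G x y → y ≢ w → Adj G x z → z ≢ w → y ≢ z → Adj G y z)
  adjacentIfNeighbours y z k = k λ xy y≢w xz z≢w y≢z →
    contradiction (y , z , xy , y≢w , xz , z≢w , y≢z , λ yz → k λ _ _ _ _ _ → yz) noPair

mainTheorem12 : ∀ {n} (G : Graph n) → NoIsolated G →
    (w x : Fin n) → EndVertexWith G w x → ¬ NbhdMinusComplete G x w →
    ¬ EdgeCritical G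
mainTheorem12 G noIsolated w x leaf notComplete (_ , critical) = absurd id
  where
  absurd : ¬ ¬ ⊥
  absurd = do
    y , z , xy , y≢w , xz , z≢w , yz@(y≢z , _) ← ¬¬-nonadjacentPair G notComplete
    k , γ ← ¬¬-γtR G (const-v2-isTRDF G noIsolated)
    k′ , γ′ ← ¬¬-γtR (plus G y z y≢z)
                (const-v2-isTRDF (plus G y z y≢z) (NoIsolated-plus G y≢z noIsolated))
    return (≤⇒≯ (γtR≤γtR-plus G y≢z leaf xy y≢w xz z≢w γ γ′)
                (critical y z yz k k′ γ γ′))
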